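{- Let $2\le k\le n-2$ and let $\lambda=\lambda_{k,n}$ be the lifting function on the vertices of $\Delta(k,n)$ with $\lambda(v_i)=1$ for $1\le i\le n-k$ and $\lambda(v_i)=0$ otherwise, where $v_1,\dots,v_{\binom nk}$ are the vertices of $\Delta(k,n)$ in descending lexicographic order. Let $C=\operatorname{conv}\{v_i : \lambda(v_i)=0\}$, a maximal cell of $\Delta(k,n)^\lambda$ with $\binom{n}{k}-n+k$ vertices. Then $C$ is not a matroid polytope. Consequently, $\lambda$ does not lie in the Dressian $\mathrm{Dr}(k,n)$.
   Context: The hypersimplex $\Delta(k,n)=\operatorname{conv}\{e_X : X\subseteq[n],\ |X|=k\}\subset\mathbb{R}^n$ with $e_X=\sum_{i\in X}e_i$; vertices are ordered in descending lexicographic order as 0/1-vectors (e.g., for $\Delta(2,4)$: $1100,1010,1001,0110,0101,0011$). A lifting function $\omega$ induces the regular subdivision $\Delta(k,n)^\omega$, whose cells are the projections (omitting the last coordinate) of the lower faces of $\operatorname{conv}\{(v,\omega(v))\}$. A matroid polytope is a polytope with 0/1 vertices all of whose edges are parallel to vectors $e_i-e_j$. The Dressian $\mathrm{Dr}(k,n)$ is the set of lifting functions $\omega$ on the vertices of $\Delta(k,n)$ such that the vertex-edge graph of $\Delta(k,n)^\omega$ coincides with that of $\Delta(k,n)$ (equivalently, all cells of $\Delta(k,n)^\omega$ are matroid polytopes). -}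

module Defs where

open import Data.Nat using (ℕ; zero; suc; _∸_)
open import Data.Bool using (Bool; true; false; if_then_else_)
import Data.Bool as B
open import Data.Fin using (Fin)
open import Data.Vec using (Vec; []; _∷_; lookup; foldr; zipWith)
import Data.Vec.Properties as VP
open import Data.List using (List; []; _∷_; [_]; map; _++_; take)
open import Data.List.Membership.Propositional using (_∈_)
open import Data.List.Relation.Unary.Any using (any?)
open import Data.Rational using (ℚ; 0ℚ; 1ℚ; _+_; _-_; _*_; _≤_; _<_)
open import Data.Product using (Σ; ∃; ∃-syntax; _×_)
open import Relation.Binary.PropositionalEquality using (_≡_; _≢_)
open import Relation.Nullary using (¬_)
open import Relation.Nullary.Decidable using (⌊_⌋)

-- 0/1-vectors are represented as Vec Bool n (true = 1).
-- All k-subsets of [n] as 0/1-vectors, in DESCENDING lexicographic order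
-- (1 > 0, first coordinate most significant).
vertices : (n k : ℕ) → List (Vec Bool n)
vertices zero    zero    = [ [] ]
vertices zero    (suc k) = []
vertices (suc n) zero    = map (false ∷_) (vertices n zero)
vertices (suc n) (suc k) = map (true ∷_) (vertices n k) ++ map (false ∷_) (vertices n (suc k))

IsVertex : (k n : ℕ) → Vec Bool n → Set
IsVertex k n v = v ∈ vertices n k

b2q : Bool → ℚ
b2q true  = 1ℚ
b2q false = 0ℚ

coord : {n : ℕ} → Vec Bool n → Fin n → ℚ
coord v i = b2q (lookup v i)

dot : {n : ℕ} → Vec ℚ n → Vec Bool n → ℚ
dot c v = foldr _ _+_ 0ℚ (zipWith (λ a b → a * b2q b) c v)

δ : {n : ℕ} → Fin n → Fin n → ℚ
δ j i = if ⌊ j Data.Fin.≟ i ⌋ then 1ℚ else 0ℚ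

lam : (k n : ℕ) → Vec Bool n → ℚ
lam k n v = if ⌊ any? (VP.≡-dec B._≟_ v) (take (n ∸ k) (vertices n k)) ⌋ then 1ℚ else 0ℚ

-- The (vertex set of the) cell of Δ(k,n)^ω cut out by the lower face with
-- linear functional c: the vertices v minimising ω(v) - ⟨c,v⟩, i.e. the lifted
-- points lying on the lower supporting hyperplane with normal (-c, 1).
LowerFace : (k n : ℕ) → (Vec Bool n → ℚ) → Vec ℚ n → Vec Bool n → Set
LowerFace k n ω c v =
  IsVertex k n v × (∀ w → IsVertex k n w → ω v - dot c v ≤ ω w - dot c w)

IsEdge : {n : ℕ} → (Vec Bool n → Set) → Vec Bool n → Vec Bool n → Set
IsEdge {n} P u v =
  P u × P v × u ≢ v ×
  ∃[ c ] (dot c u ≡ dot c v × (∀ w → P w → w ≢ u → w ≢ v → dot c w < dot c u))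

ParallelToRoot : {n : ℕ} → Vec Bool n → Vec Bool n → Set
ParallelToRoot {n} u v =
  ∃[ i ] ∃[ j ] (i ≢ j × ∃[ t ] (∀ l → coord u l - coord v l ≡ t * (δ i l - δ j l)))

-- conv(P) (P a set of 0/1 points) is a matroid polytope: every edge is
-- parallel to some e_i - e_j.  (0/1 vertices are automatic.)
IsMatroidPolytope : {n : ℕ} → (Vec Bool n → Set) → Set
IsMatroidPolytope P = ∀ u v → IsEdge P u v → ParallelToRoot u v

InDressian : (k n : ℕ) → (Vec Bool n → ℚ) → Set
InDressian k n ω = ∀ c → IsMatroidPolytope (LowerFace k n ω c)

Ccell : (k n : ℕ) → Vec Bool n → Set
Ccell k n v = IsVertex k n v × lam k n v ≡ 0ℚ

{-# OPTIONS --safe #-}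

-- λ is the indicator function of the n − k raised vertices 1^{k−1} e_j, where
-- e_j ∈ {0,1}^{n−k+1} and j ≤ n − k.  As λ ≥ 0, the zero functional cuts out the cell
-- C = λ⁻¹(0).  Every raised x satisfies x + w = w′ + w″ for vertices w, w′, w″ of C, and
-- ω − ⟨c,·⟩ is minimal on a lower face, so there ω(x) + ω(w) ≤ ω(w′) + ω(w″); for a face
-- containing C this reads 1 ≤ 0, hence C is maximal.  The vertices u = 1^{k−1} 0 0…0 1 and
-- v = 1^{k−2} 0 1 1 0…0 of C span an edge, exposed by (3,…,3,2,1,1,0,…,0), but differ in
-- more than two coordinates, so u − v is parallel to no e_i − e_j: C is not a matroid
-- polytope, and since it is a cell, λ ∉ Dr(k,n).

module Submission where

open import Defs
open import Data.Nat using (ℕ; _≤_; _+_)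
open import Data.Vec using (Vec)
open import Data.Bool using (Bool)
open import Data.Product using (∃-syntax; _×_)
open import Relation.Nullary using (¬_)

open import Algebra.Bundles using (CommutativeMonoid)
open import Data.Bool using (true; false)
import Data.Bool as Bool
open import Data.Empty using (⊥)
open import Data.Fin as Fin using (Fin; zero; suc; fromℕ; inject₁)
open import Data.Fin.Properties using (suc-injective)
open import Data.List using (List; _∷_; [_]; map; _++_; take; length)
open import Data.List.Properties using (length-map; length-++; take-map)
open import Data.List.Membership.Propositional using (_∈_; _∉_)
open import Data.List.Membership.Propositional.Properties
  using (∈-map⁺; ∈-map⁻; ∈-++⁺ˡ; ∈-++⁺ʳ; ∈-++⁻)
open import Data.List.Relation.Unary.Any using (here; there; any?)
open import Data.Nat as ℕ using (zero; suc; _∸_; z≤n; s≤s)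
import Data.Nat.Properties as ℕ
open import Data.Product using (_,_; proj₁; proj₂; ∃₂)
open import Data.Rational using (ℚ; 0ℚ; 1ℚ; _-_; _*_; _<_; _≤?_; _<?_)
  renaming (_+_ to _+ℚ_; _≤_ to _≤ℚ_)
import Data.Rational.Properties as ℚ
open import Algebra.Properties.CommutativeSemigroup
  (CommutativeMonoid.commutativeSemigroup ℚ.+-0-commutativeMonoid) using (interchange)
open import Data.Rational.Solver using (module +-*-Solver)
open import Data.Sum using (_⊎_; inj₁; inj₂)
open import Data.Vec using ([]; _∷_; lookup; replicate) renaming (_++_ to _++ᵛ_)
import Data.Vec.Properties as Vecₚ
open import Function using (_∘_)
open import Relation.Binary.PropositionalEquality
  using (_≡_; _≢_; refl; sym; trans; cong; cong₂; subst; subst₂; module ≡-Reasoning)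
open import Relation.Nullary using (Dec; yes; no; contradiction)
open import Relation.Nullary.Decidable using (True; toWitness; from-yes; from-no)

2ℚ 3ℚ : ℚ
2ℚ = 1ℚ +ℚ 1ℚ
3ℚ = 2ℚ +ℚ 1ℚ

private
  variable
    k n : ℕ
    a b : Bool
    x : Vec Bool n

take-++ˡ : ∀ {A : Set} m (xs ys : List A) → m ≤ length xs → take m (xs ++ ys) ≡ take m xs
take-++ˡ zero    xs       ys _         = refl
take-++ˡ (suc m) (x ∷ xs) ys (s≤s m≤) = cong (x ∷_) (take-++ˡ m xs ys m≤)

∈-map-∷⁻ : ∀ {n a b} {x : Vec Bool n} {xs} → (a ∷ x) ∈ map (b ∷_) xs → a ≡ b × x ∈ xs
∈-map-∷⁻ {b = b} p with ∈-map⁻ (b ∷_) p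
... | _ , x∈xs , refl = refl , x∈xs

-- Vertices of Δ(k,n)

∈vertices-true⁺ : x ∈ vertices n k → (true ∷ x) ∈ vertices (suc n) (suc k)
∈vertices-true⁺ p = ∈-++⁺ˡ (∈-map⁺ (true ∷_) p)

∈vertices-true⁻ : (true ∷ x) ∈ vertices (suc n) (suc k) → x ∈ vertices n k
∈vertices-true⁻ {n = n} {k = k} p with ∈-++⁻ (map (true ∷_) (vertices n k)) p
... | inj₁ q = proj₂ (∈-map-∷⁻ q)
... | inj₂ q = contradiction (proj₁ (∈-map-∷⁻ q)) λ ()

∈vertices-false⁺ : x ∈ vertices n k → (false ∷ x) ∈ vertices (suc n) k
∈vertices-false⁺ {k = zero}      p = ∈-map⁺ (false ∷_) p
∈vertices-false⁺ {n = n} {k = suc k} p = ∈-++⁺ʳ (map (true ∷_) (vertices n k)) (∈-map⁺ (false ∷_) p)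

∈vertices-false⁻ : (false ∷ x) ∈ vertices (suc n) k → x ∈ vertices n k
∈vertices-false⁻ {k = zero} p = proj₂ (∈-map-∷⁻ p)
∈vertices-false⁻ {n = n} {k = suc k} p with ∈-++⁻ (map (true ∷_) (vertices n k)) p
... | inj₁ q = contradiction (proj₁ (∈-map-∷⁻ q)) λ ()
... | inj₂ q = proj₂ (∈-map-∷⁻ q)

vertices-zero : ∀ n → vertices n 0 ≡ [ replicate n false ]
vertices-zero zero    = refl
vertices-zero (suc n) = cong (map (false ∷_)) (vertices-zero n)

∈vertices-zero⁻ : x ∈ vertices n 0 → x ≡ replicate n false
∈vertices-zero⁻ {n = n} p with subst (_ ∈_) (vertices-zero n) p
... | here x≡0 = x≡0

zeros∈vertices : ∀ n → replicate n false ∈ vertices n 0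
zeros∈vertices n = subst (replicate n false ∈_) (sym (vertices-zero n)) (here refl)

unit : Fin n → Vec Bool n
unit zero    = true ∷ replicate _ false
unit (suc i) = false ∷ unit i

unit∈vertices : (i : Fin n) → unit i ∈ vertices n 1
unit∈vertices {suc n} zero = ∈vertices-true⁺ (zeros∈vertices n)
unit∈vertices (suc i)      = ∈vertices-false⁺ (unit∈vertices i)

length-vertices-suc : ∀ n k →
  length (vertices (suc n) (suc k)) ≡ length (vertices n k) + length (vertices n (suc k))
length-vertices-suc n k = trans (length-++ (map (true ∷_) (vertices n k)))
  (cong₂ _+_ (length-map (true ∷_) (vertices n k)) (length-map (false ∷_) (vertices n (suc k))))

∸≤length-vertices : ∀ n k → n ∸ suc k ≤ length (vertices n (suc k))
∸≤length-vertices zero    k       = z≤n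
∸≤length-vertices (suc n) zero    = begin
  n                                              ≤⟨ ℕ.m≤n+m∸n n 1 ⟩
  1 + (n ∸ 1)                                    ≤⟨ ℕ.+-monoʳ-≤ 1 (∸≤length-vertices n 0) ⟩
  1 + length (vertices n 1)
    ≡⟨ cong (λ vs → length vs + length (vertices n 1)) (vertices-zero n) ⟨
  length (vertices n 0) + length (vertices n 1)  ≡⟨ length-vertices-suc n 0 ⟨
  length (vertices (suc n) 1)                    ∎
  where open ℕ.≤-Reasoning
∸≤length-vertices (suc n) (suc k) = begin
  n ∸ suc k                                                  ≤⟨ ∸≤length-vertices n k ⟩
  length (vertices n (suc k))                                ≤⟨ ℕ.m≤m+n _ _ ⟩
  length (vertices n (suc k)) + length (vertices n (2 + k))  ≡⟨ length-vertices-suc n (suc k) ⟨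
  length (vertices (suc n) (2 + k))                          ∎
  where open ℕ.≤-Reasoning

-- The cell C = λ⁻¹(0)

raised : (k n : ℕ) → List (Vec Bool n)
raised k n = take (n ∸ k) (vertices n k)

raised? : ∀ k n (x : Vec Bool n) → Dec (x ∈ raised k n)
raised? k n x = any? (Vecₚ.≡-dec Bool._≟_ x) (raised k n)

lam-raised : ∀ {k n} {x : Vec Bool n} → x ∈ raised k n → lam k n x ≡ 1ℚ
lam-raised {k} {n} {x} r with raised? k n x
... | yes _  = refl
... | no x∉ = contradiction r x∉

lam-unraised : ∀ {k n} {x : Vec Bool n} → x ∉ raised k n → lam k n x ≡ 0ℚ
lam-unraised {k} {n} {x} x∉ with raised? k n x
... | yes r = contradiction r x∉
... | no _  = refl

lam-nonneg : ∀ k n (x : Vec Bool n) → 0ℚ ≤ℚ lam k n x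
lam-nonneg k n x with raised? k n x
... | yes _ = from-yes (0ℚ ≤? 1ℚ)
... | no  _ = ℚ.≤-refl

raised-suc : ∀ n k → raised (2 + k) (suc n) ≡ map (true ∷_) (raised (suc k) n)
raised-suc n k = begin
  take (n ∸ suc k) (map (true ∷_) (vertices n (suc k)) ++ map (false ∷_) (vertices n (2 + k)))
    ≡⟨ take-++ˡ (n ∸ suc k) _ _
         (subst (n ∸ suc k ≤_) (sym (length-map (true ∷_) (vertices n (suc k))))
                (∸≤length-vertices n k)) ⟩
  take (n ∸ suc k) (map (true ∷_) (vertices n (suc k)))
    ≡⟨ take-map (n ∸ suc k) (vertices n (suc k)) ⟩
  map (true ∷_) (raised (suc k) n) ∎
  where open ≡-Reasoning

true∷∈raised⁺ : x ∈ raised (suc k) n → (true ∷ x) ∈ raised (2 + k) (suc n)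
true∷∈raised⁺ {n = n} {k = k} r = subst (_ ∈_) (sym (raised-suc n k)) (∈-map⁺ (true ∷_) r)

∷∈raised⁻ : (a ∷ x) ∈ raised (2 + k) (suc n) → a ≡ true × x ∈ raised (suc k) n
∷∈raised⁻ {n = n} {k = k} r = ∈-map-∷⁻ (subst (_ ∈_) (raised-suc n k) r)

Ccell⁺ : IsVertex k n x → x ∉ raised k n → Ccell k n x
Ccell⁺ x∈V x∉ = x∈V , lam-unraised x∉

Ccell⇒∉raised : Ccell k n x → x ∉ raised k n
Ccell⇒∉raised (_ , λx≡0) r with () ← trans (sym (lam-raised r)) λx≡0

Ccell-true⁺ : Ccell (suc k) n x → Ccell (2 + k) (suc n) (true ∷ x)
Ccell-true⁺ {k = k} Cx@(x∈V , _) =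
  Ccell⁺ {k = 2 + k} (∈vertices-true⁺ x∈V) (Ccell⇒∉raised {k = suc k} Cx ∘ proj₂ ∘ ∷∈raised⁻ {k = k})

Ccell-true⁻ : Ccell (2 + k) (suc n) (true ∷ x) → Ccell (suc k) n x
Ccell-true⁻ {k = k} Cx@(x∈V , _) =
  Ccell⁺ {k = suc k} (∈vertices-true⁻ x∈V) (Ccell⇒∉raised {k = 2 + k} Cx ∘ true∷∈raised⁺ {k = k})

Ccell-false⁺ : IsVertex (2 + k) n x → Ccell (2 + k) (suc n) (false ∷ x)
Ccell-false⁺ {k = k} x∈V =
  Ccell⁺ {k = 2 + k} (∈vertices-false⁺ x∈V) (λ r → contradiction (proj₁ (∷∈raised⁻ {k = k} r)) λ ())

raised₁-suc : ∀ q → raised 1 (2 + q) ≡ unit zero ∷ map (false ∷_) (raised 1 (suc q))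
raised₁-suc q = begin
  take (suc q) (map (true ∷_) (vertices (suc q) 0) ++ map (false ∷_) (vertices (suc q) 1))
    ≡⟨ cong (λ vs → take (suc q) (map (true ∷_) vs ++ map (false ∷_) (vertices (suc q) 1)))
            (vertices-zero (suc q)) ⟩
  unit zero ∷ take q (map (false ∷_) (vertices (suc q) 1))
    ≡⟨ cong (unit zero ∷_) (take-map q (vertices (suc q) 1)) ⟩
  unit zero ∷ map (false ∷_) (raised 1 (suc q)) ∎
  where open ≡-Reasoning

∈raised₁⇒unit-inject₁ : ∀ q {x : Vec Bool (suc q)} →
  x ∈ raised 1 (suc q) → ∃[ i ] x ≡ unit (inject₁ i)
∈raised₁⇒unit-inject₁ (suc q) {x} r with subst (x ∈_) (raised₁-suc q) r
... | here refl = zero , refl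
... | there r′ with ∈-map⁻ (false ∷_) r′
...   | _ , y∈ , refl with ∈raised₁⇒unit-inject₁ q y∈
...     | i , refl = suc i , refl

unit-fromℕ∉raised₁ : ∀ q → unit (fromℕ q) ∉ raised 1 (suc q)
unit-fromℕ∉raised₁ (suc q) r with subst (unit (fromℕ (suc q)) ∈_) (raised₁-suc q) r
... | here ()
... | there r′ = unit-fromℕ∉raised₁ q (proj₂ (∈-map-∷⁻ r′))

Ccell₁⇒unit-fromℕ : ∀ q {x : Vec Bool (suc q)} → Ccell 1 (suc q) x → x ≡ unit (fromℕ q)
Ccell₁⇒unit-fromℕ zero (here refl , _) = refl
Ccell₁⇒unit-fromℕ (suc q) {true ∷ y} Cx@(x∈V , _)
  with refl ← ∈vertices-zero⁻ (∈vertices-true⁻ x∈V) =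
  contradiction (subst (unit zero ∈_) (sym (raised₁-suc q)) (here refl)) (Ccell⇒∉raised {k = 1} Cx)
Ccell₁⇒unit-fromℕ (suc q) {false ∷ y} Cx@(x∈V , _) =
  cong (false ∷_) (Ccell₁⇒unit-fromℕ q (Ccell⁺ {k = 1} (∈vertices-false⁻ {k = 1} x∈V) y∉))
  where
  y∉ : y ∉ raised 1 (suc q)
  y∉ r = Ccell⇒∉raised {k = 1} Cx
    (subst (false ∷ y ∈_) (sym (raised₁-suc q)) (there (∈-map⁺ (false ∷_) r)))

-- Lower faces and exchanges

dot-zeros : ∀ {n} (w : Vec Bool n) → dot (replicate n 0ℚ) w ≡ 0ℚ
dot-zeros []      = refl
dot-zeros (a ∷ w) = cong₂ _+ℚ_ (ℚ.*-zeroˡ (b2q a)) (dot-zeros w)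

dot-++-zeros : ∀ {m n} (c : Vec ℚ m) (x : Vec Bool m) (w : Vec Bool n) →
  dot (c ++ᵛ replicate n 0ℚ) (x ++ᵛ w) ≡ dot c x
dot-++-zeros []      []      w = dot-zeros w
dot-++-zeros (c ∷ cs) (a ∷ x) w = cong (c * b2q a +ℚ_) (dot-++-zeros cs x w)

data SameSum : ∀ {n} → Vec Bool n → Vec Bool n → Vec Bool n → Vec Bool n → Set where
  nil  : SameSum [] [] [] []
  keep : ∀ {n a b} {x y z w : Vec Bool n} →
         SameSum x y z w → SameSum (a ∷ x) (b ∷ y) (a ∷ z) (b ∷ w)
  swap : ∀ {n a b} {x y z w : Vec Bool n} →
         SameSum x y z w → SameSum (a ∷ x) (b ∷ y) (b ∷ z) (a ∷ w)

sameSum-swap : ∀ {n} (x y : Vec Bool n) → SameSum x y y x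
sameSum-swap []      []      = nil
sameSum-swap (a ∷ x) (b ∷ y) = swap (sameSum-swap x y)

dot-sameSum : ∀ {n} (c : Vec ℚ n) {x y z w} → SameSum x y z w →
  dot c x +ℚ dot c y ≡ dot c z +ℚ dot c w
dot-sameSum [] nil = refl
dot-sameSum (c ∷ cs) {a ∷ x} {b ∷ y} {_ ∷ z} {_ ∷ w} (keep s) = begin
  (p +ℚ dot cs x) +ℚ (q +ℚ dot cs y)  ≡⟨ interchange p _ q _ ⟩
  (p +ℚ q) +ℚ (dot cs x +ℚ dot cs y)  ≡⟨ cong ((p +ℚ q) +ℚ_) (dot-sameSum cs s) ⟩
  (p +ℚ q) +ℚ (dot cs z +ℚ dot cs w)  ≡⟨ interchange p q _ _ ⟩
  (p +ℚ dot cs z) +ℚ (q +ℚ dot cs w)  ∎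
  where
  open ≡-Reasoning
  p q : ℚ
  p = c * b2q a
  q = c * b2q b
dot-sameSum (c ∷ cs) {a ∷ x} {b ∷ y} {_ ∷ z} {_ ∷ w} (swap s) = begin
  (p +ℚ dot cs x) +ℚ (q +ℚ dot cs y)  ≡⟨ interchange p _ q _ ⟩
  (p +ℚ q) +ℚ (dot cs x +ℚ dot cs y)  ≡⟨ cong₂ _+ℚ_ (ℚ.+-comm p q) (dot-sameSum cs s) ⟩
  (q +ℚ p) +ℚ (dot cs z +ℚ dot cs w)  ≡⟨ interchange q p _ _ ⟩
  (q +ℚ dot cs z) +ℚ (p +ℚ dot cs w)  ∎
  where
  open ≡-Reasoning
  p q : ℚ
  p = c * b2q a
  q = c * b2q b

record Exchange {n} (P : Vec Bool n → Set) (x : Vec Bool n) : Set where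
  field
    w w′ w″ : Vec Bool n
    P-w     : P w
    P-w′    : P w′
    P-w″    : P w″
    sameSum : SameSum x w w′ w″

exchange-true∷ : ∀ {n} {P : Vec Bool n → Set} {Q : Vec Bool (suc n) → Set} {x} →
  (∀ {y} → P y → Q (true ∷ y)) → Exchange P x → Exchange Q (true ∷ x)
exchange-true∷ P⇒Q E = record
  { P-w = P⇒Q P-w ; P-w′ = P⇒Q P-w′ ; P-w″ = P⇒Q P-w″ ; sameSum = keep sameSum }
  where open Exchange E

lowerFace-sameSum : ∀ {k n ω c} {x y z w : Vec Bool n} →
  LowerFace k n ω c x → LowerFace k n ω c y → IsVertex k n z → IsVertex k n w →
  SameSum x y z w → ω x +ℚ ω y ≤ℚ ω z +ℚ ω w
lowerFace-sameSum {ω = ω} {c} {x} {y} {z} {w} (_ , x-min) (_ , y-min) z∈V w∈V s = begin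
  ω x +ℚ ω y
    ≡⟨ shift (ω x) (ω y) _ _ ⟩
  ((ω x - dot c x) +ℚ (ω y - dot c y)) +ℚ (dot c x +ℚ dot c y)
    ≤⟨ ℚ.+-monoˡ-≤ (dot c x +ℚ dot c y) (ℚ.+-mono-≤ (x-min z z∈V) (y-min w w∈V)) ⟩
  ((ω z - dot c z) +ℚ (ω w - dot c w)) +ℚ (dot c x +ℚ dot c y)
    ≡⟨ cong (((ω z - dot c z) +ℚ (ω w - dot c w)) +ℚ_) (dot-sameSum c s) ⟩
  ((ω z - dot c z) +ℚ (ω w - dot c w)) +ℚ (dot c z +ℚ dot c w)
    ≡⟨ shift (ω z) (ω w) _ _ ⟨
  ω z +ℚ ω w
    ∎
  where
  open ℚ.≤-Reasoning
  open +-*-Solver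
  shift : ∀ p q s t → p +ℚ q ≡ ((p - s) +ℚ (q - t)) +ℚ (s +ℚ t)
  shift = solve 4 (λ p q s t → p :+ q := ((p :- s) :+ (q :- t)) :+ (s :+ t)) refl

-- A record rather than a function type, so that k and n can be inferred from it.
record RaisedExchangeable (k n : ℕ) : Set where
  field exchange : ∀ {x} → x ∈ raised k n → Exchange (Ccell k n) x

raised∉lowerFace : ∀ {k n c x} → RaisedExchangeable k n →
  (∀ v → Ccell k n v → LowerFace k n (lam k n) c v) →
  x ∈ raised k n → ¬ LowerFace k n (lam k n) c x
raised∉lowerFace {k} {n} {c} X C⊆F r x∈F = from-no (1ℚ +ℚ 0ℚ ≤? 0ℚ +ℚ 0ℚ) 1+0≤0+0
  where
  open Exchange (RaisedExchangeable.exchange X r)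
  1+0≤0+0 : 1ℚ +ℚ 0ℚ ≤ℚ 0ℚ +ℚ 0ℚ
  1+0≤0+0 = subst₂ _≤ℚ_
    (cong₂ _+ℚ_ (lam-raised {k} r) (proj₂ P-w)) (cong₂ _+ℚ_ (proj₂ P-w′) (proj₂ P-w″))
    (lowerFace-sameSum {ω = lam k n} {c} x∈F (C⊆F w P-w) (proj₁ P-w′) (proj₁ P-w″) sameSum)

Ccell-maximal : ∀ {k n} → RaisedExchangeable k n →
  ∀ c → (∀ v → Ccell k n v → LowerFace k n (lam k n) c v) →
  ∀ v → LowerFace k n (lam k n) c v → Ccell k n v
Ccell-maximal {k} X c C⊆F x x∈F =
  Ccell⁺ {k = k} (proj₁ x∈F) (λ r → raised∉lowerFace {k} {c = c} X C⊆F r x∈F)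

Ccell⊆lowerFace₀ : ∀ {k n v} → Ccell k n v → LowerFace k n (lam k n) (replicate n 0ℚ) v
Ccell⊆lowerFace₀ {k} {n} {v} (v∈V , λv≡0) = v∈V , λ w _ → begin
  lam k n v - dot (replicate n 0ℚ) v  ≡⟨ cong₂ _-_ λv≡0 (dot-zeros v) ⟩
  0ℚ                                  ≤⟨ lam-nonneg k n w ⟩
  lam k n w                           ≡⟨ ℚ.+-identityʳ (lam k n w) ⟨
  lam k n w - 0ℚ                      ≡⟨ cong (lam k n w -_) (dot-zeros w) ⟨
  lam k n w - dot (replicate n 0ℚ) w  ∎
  where open ℚ.≤-Reasoning

Ccell-isLowerFace₀ : ∀ {k n} → RaisedExchangeable k n →
  ∀ v → (Ccell k n v → LowerFace k n (lam k n) (replicate n 0ℚ) v)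
      × (LowerFace k n (lam k n) (replicate n 0ℚ) v → Ccell k n v)
Ccell-isLowerFace₀ X v =
  Ccell⊆lowerFace₀ , Ccell-maximal X (replicate _ 0ℚ) (λ _ → Ccell⊆lowerFace₀) v

-- Edges not parallel to any e_i − e_j

isEdge-resp : ∀ {n} {P Q : Vec Bool n → Set} {u v} →
  (∀ {w} → P w → Q w) → (∀ {w} → Q w → P w) → IsEdge P u v → IsEdge Q u v
isEdge-resp P⇒Q Q⇒P (P-u , P-v , u≢v , c , tie , below) =
  P⇒Q P-u , P⇒Q P-v , u≢v , c , tie , λ w → below w ∘ Q⇒P

isMatroidPolytope-resp : ∀ {n} {P Q : Vec Bool n → Set} →
  (∀ {w} → P w → Q w) → (∀ {w} → Q w → P w) → IsMatroidPolytope Q → IsMatroidPolytope P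
isMatroidPolytope-resp P⇒Q Q⇒P M u v = M u v ∘ isEdge-resp P⇒Q Q⇒P

¬matroidCcell⇒∉Dressian : ∀ {k n} → RaisedExchangeable k n →
  ¬ IsMatroidPolytope (Ccell k n) → ¬ InDressian k n (lam k n)
¬matroidCcell⇒∉Dressian X ¬M inDr =
  ¬M (isMatroidPolytope-resp (proj₁ (Ccell-isLowerFace₀ X _)) (proj₂ (Ccell-isLowerFace₀ X _))
                             (inDr (replicate _ 0ℚ)))

δ-off : ∀ {n} {i l : Fin n} → i ≢ l → δ i l ≡ 0ℚ
δ-off {i = i} {l} i≢l with i Fin.≟ l
... | yes i≡l = contradiction i≡l i≢l
... | no  _   = refl

b2q-sub≢0 : a ≢ b → b2q a - b2q b ≢ 0ℚ
b2q-sub≢0 {true}  {true}  a≢b _ = a≢b refl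
b2q-sub≢0 {false} {false} a≢b _ = a≢b refl
b2q-sub≢0 {true}  {false} _ ()
b2q-sub≢0 {false} {true}  _ ()

parallelToRoot-support : ∀ {n} {u v : Vec Bool n} → ParallelToRoot u v →
  ∃₂ λ i j → ∀ l → lookup u l ≢ lookup v l → i ≡ l ⊎ j ≡ l
parallelToRoot-support {u = u} {v} (i , j , _ , t , u-v≡t[eᵢ-eⱼ]) = i , j , support
  where
  support : ∀ l → lookup u l ≢ lookup v l → i ≡ l ⊎ j ≡ l
  support l uₗ≢vₗ with i Fin.≟ l | j Fin.≟ l
  ... | yes i≡l | _       = inj₁ i≡l
  ... | no  _   | yes j≡l = inj₂ j≡l
  ... | no  i≢l | no  j≢l = contradiction (begin
    coord u l - coord v l  ≡⟨ u-v≡t[eᵢ-eⱼ] l ⟩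
    t * (δ i l - δ j l)    ≡⟨ cong (t *_) (cong₂ _-_ (δ-off i≢l) (δ-off j≢l)) ⟩
    t * 0ℚ                 ≡⟨ ℚ.*-zeroʳ t ⟩
    0ℚ                     ∎) (b2q-sub≢0 uₗ≢vₗ)
    where open ≡-Reasoning

no-three-in-pair : ∀ {n} {i j l₁ l₂ l₃ : Fin n} → l₁ ≢ l₂ → l₁ ≢ l₃ → l₂ ≢ l₃ →
  i ≡ l₁ ⊎ j ≡ l₁ → i ≡ l₂ ⊎ j ≡ l₂ → i ≡ l₃ ⊎ j ≡ l₃ → ⊥
no-three-in-pair l₁≢l₂ _     _     (inj₁ refl) (inj₁ refl) _           = l₁≢l₂ refl
no-three-in-pair l₁≢l₂ _     _     (inj₂ refl) (inj₂ refl) _           = l₁≢l₂ refl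
no-three-in-pair _     l₁≢l₃ _     (inj₁ refl) (inj₂ refl) (inj₁ refl) = l₁≢l₃ refl
no-three-in-pair _     _     l₂≢l₃ (inj₁ refl) (inj₂ refl) (inj₂ refl) = l₂≢l₃ refl
no-three-in-pair _     _     l₂≢l₃ (inj₂ refl) (inj₁ refl) (inj₁ refl) = l₂≢l₃ refl
no-three-in-pair _     l₁≢l₃ _     (inj₂ refl) (inj₁ refl) (inj₂ refl) = l₁≢l₃ refl

record DifferInThree {n} (u v : Vec Bool n) : Set where
  field
    l₁ l₂ l₃ : Fin n
    l₁≢l₂    : l₁ ≢ l₂
    l₁≢l₃    : l₁ ≢ l₃
    l₂≢l₃    : l₂ ≢ l₃
    differ₁  : lookup u l₁ ≢ lookup v l₁
    differ₂  : lookup u l₂ ≢ lookup v l₂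
    differ₃  : lookup u l₃ ≢ lookup v l₃

differInThree-∷ : ∀ {n} {u v : Vec Bool n} → DifferInThree u v → DifferInThree (a ∷ u) (a ∷ v)
differInThree-∷ D = record
  { l₁ = suc l₁ ; l₂ = suc l₂ ; l₃ = suc l₃
  ; l₁≢l₂ = l₁≢l₂ ∘ suc-injective
  ; l₁≢l₃ = l₁≢l₃ ∘ suc-injective
  ; l₂≢l₃ = l₂≢l₃ ∘ suc-injective
  ; differ₁ = differ₁ ; differ₂ = differ₂ ; differ₃ = differ₃
  }
  where open DifferInThree D

differInThree⇒≢ : ∀ {n} {u v : Vec Bool n} → DifferInThree u v → u ≢ v
differInThree⇒≢ D u≡v = differ₁ (cong (λ t → lookup t l₁) u≡v)
  where open DifferInThree D

differInThree⇒¬parallelToRoot : ∀ {n} {u v : Vec Bool n} →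
  DifferInThree u v → ¬ ParallelToRoot u v
differInThree⇒¬parallelToRoot {u = u} {v} D par with parallelToRoot-support {u = u} {v} par
... | _ , _ , support =
  no-three-in-pair l₁≢l₂ l₁≢l₃ l₂≢l₃ (support l₁ differ₁) (support l₂ differ₂) (support l₃ differ₃)
  where open DifferInThree D

record ExposedEdge {n} (P : Vec Bool n → Set) (u v : Vec Bool n) : Set where
  field
    P-u      : P u
    P-v      : P v
    c        : Vec ℚ n
    tie      : dot c u ≡ dot c v
    below    : ∀ w → P w → w ≢ u → w ≢ v → dot c w < dot c u
    headroom : ∀ w → dot c w ≤ℚ dot c u +ℚ 2ℚ

exposedEdge⇒isEdge : ∀ {n} {P : Vec Bool n → Set} {u v} →
  u ≢ v → ExposedEdge P u v → IsEdge P u v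
exposedEdge⇒isEdge u≢v E = P-u , P-v , u≢v , c , tie , below
  where open ExposedEdge E

-- A leading coordinate of weight 3 outweighs the headroom 2 of the others, so
-- only points starting with 1 can come close to the top.
exposedEdge-true∷ : ∀ {n} {P : Vec Bool n → Set} {Q : Vec Bool (suc n) → Set} {u v} →
  (∀ {w} → Q (true ∷ w) → P w) → Q (true ∷ u) → Q (true ∷ v) →
  ExposedEdge P u v → ExposedEdge Q (true ∷ u) (true ∷ v)
exposedEdge-true∷ {n} {P} {Q} {u} {v} Q⇒P Q-u Q-v E = record
  { P-u      = Q-u
  ; P-v      = Q-v
  ; c        = 3ℚ ∷ c
  ; tie      = cong (3ℚ +ℚ_) tie
  ; below    = below′
  ; headroom = headroom′
  }
  where
  open ExposedEdge E
  open ℚ.≤-Reasoning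

  false∷-below : ∀ w → dot (3ℚ ∷ c) (false ∷ w) < 3ℚ +ℚ dot c u
  false∷-below w = begin-strict
    3ℚ * 0ℚ +ℚ dot c w  ≡⟨ ℚ.+-identityˡ (dot c w) ⟩
    dot c w             ≤⟨ headroom w ⟩
    dot c u +ℚ 2ℚ       <⟨ ℚ.+-monoʳ-< (dot c u) (from-yes (2ℚ <? 3ℚ)) ⟩
    dot c u +ℚ 3ℚ       ≡⟨ ℚ.+-comm (dot c u) 3ℚ ⟩
    3ℚ +ℚ dot c u       ∎

  below′ : ∀ w → Q w → w ≢ true ∷ u → w ≢ true ∷ v → dot (3ℚ ∷ c) w < 3ℚ +ℚ dot c u
  below′ (true ∷ w) Q-w w≢u w≢v =
    ℚ.+-monoʳ-< 3ℚ (below w (Q⇒P Q-w) (w≢u ∘ cong (true ∷_)) (w≢v ∘ cong (true ∷_)))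
  below′ (false ∷ w) _ _ _ = false∷-below w

  headroom′ : ∀ w → dot (3ℚ ∷ c) w ≤ℚ (3ℚ +ℚ dot c u) +ℚ 2ℚ
  headroom′ (true ∷ w) = begin
    3ℚ +ℚ dot c w          ≤⟨ ℚ.+-monoʳ-≤ 3ℚ (headroom w) ⟩
    3ℚ +ℚ (dot c u +ℚ 2ℚ)  ≡⟨ ℚ.+-assoc 3ℚ (dot c u) 2ℚ ⟨
    (3ℚ +ℚ dot c u) +ℚ 2ℚ  ∎
  headroom′ (false ∷ w) = begin
    dot (3ℚ ∷ c) (false ∷ w)  <⟨ false∷-below w ⟩
    3ℚ +ℚ dot c u             ≡⟨ ℚ.+-identityʳ (3ℚ +ℚ dot c u) ⟨
    (3ℚ +ℚ dot c u) +ℚ 0ℚ     ≤⟨ ℚ.+-monoʳ-≤ (3ℚ +ℚ dot c u) (from-yes (0ℚ ≤? 2ℚ)) ⟩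
    (3ℚ +ℚ dot c u) +ℚ 2ℚ     ∎

exposedEdge⇒¬isMatroidPolytope : ∀ {n} {P : Vec Bool n → Set} {u v} →
  ExposedEdge P u v → DifferInThree u v → ¬ IsMatroidPolytope P
exposedEdge⇒¬isMatroidPolytope {u = u} {v} E D M =
  differInThree⇒¬parallelToRoot D (M u v (exposedEdge⇒isEdge (differInThree⇒≢ D) E))

-- Induction on k, from k = 2

<-decide : ∀ {p q} {_ : True (p <? q)} → p < q
<-decide {_} {_} {p<q} = toWitness p<q

≤-decide : ∀ {p q} {_ : True (p ≤? q)} → p ≤ℚ q
≤-decide {_} {_} {p≤q} = toWitness p≤q

module Base (b : ℕ) where

  u₀ v₀ : Vec Bool (4 + b)
  u₀ = true ∷ unit (fromℕ (2 + b))
  v₀ = false ∷ true ∷ true ∷ replicate (suc b) false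

  c₃ : Vec ℚ 3
  c₃ = 2ℚ ∷ 1ℚ ∷ 1ℚ ∷ []

  c₀ : Vec ℚ (4 + b)
  c₀ = c₃ ++ᵛ replicate (suc b) 0ℚ

  dot-c₀ : ∀ a₁ a₂ a₃ (w : Vec Bool (suc b)) →
    dot c₀ (a₁ ∷ a₂ ∷ a₃ ∷ w) ≡ dot c₃ (a₁ ∷ a₂ ∷ a₃ ∷ [])
  dot-c₀ a₁ a₂ a₃ = dot-++-zeros c₃ (a₁ ∷ a₂ ∷ a₃ ∷ [])

  dot-c₀-u₀ : dot c₀ u₀ ≡ 2ℚ
  dot-c₀-u₀ = dot-c₀ true false false (unit (fromℕ b))

  dot-c₀-v₀ : dot c₀ v₀ ≡ 2ℚ
  dot-c₀-v₀ = dot-c₀ false true true (replicate (suc b) false)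

  C-u₀ : Ccell 2 (4 + b) u₀
  C-u₀ = Ccell-true⁺ {k = 0}
    (Ccell⁺ {k = 1} (unit∈vertices (fromℕ (2 + b))) (unit-fromℕ∉raised₁ (2 + b)))

  C-v₀ : Ccell 2 (4 + b) v₀
  C-v₀ = Ccell-false⁺ {k = 0}
    (∈vertices-true⁺ {k = 1} (∈vertices-true⁺ {k = 0} (zeros∈vertices (suc b))))

  below₀ : ∀ w → Ccell 2 (4 + b) w → w ≢ u₀ → w ≢ v₀ → dot c₀ w < dot c₀ u₀
  below₀ (true ∷ w) C-w w≢u₀ _ =
    contradiction (cong (true ∷_) (Ccell₁⇒unit-fromℕ (2 + b) (Ccell-true⁻ {k = 0} C-w))) w≢u₀
  below₀ (false ∷ true ∷ true ∷ w) (w∈V , _) _ w≢v₀ =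
    contradiction (cong (λ t → false ∷ true ∷ true ∷ t) (∈vertices-zero⁻
      (∈vertices-true⁻ {k = 0} (∈vertices-true⁻ {k = 1} (∈vertices-false⁻ {k = 2} w∈V))))) w≢v₀
  below₀ (false ∷ true ∷ false ∷ w) _ _ _ =
    subst₂ _<_ (sym (dot-c₀ false true false w)) (sym dot-c₀-u₀) <-decide
  below₀ (false ∷ false ∷ true ∷ w) _ _ _ =
    subst₂ _<_ (sym (dot-c₀ false false true w)) (sym dot-c₀-u₀) <-decide
  below₀ (false ∷ false ∷ false ∷ w) _ _ _ =
    subst₂ _<_ (sym (dot-c₀ false false false w)) (sym dot-c₀-u₀) <-decide

  headroom₃ : ∀ a₁ a₂ a₃ → dot c₃ (a₁ ∷ a₂ ∷ a₃ ∷ []) ≤ℚ 2ℚ +ℚ 2ℚ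
  headroom₃ true  true  true  = ≤-decide
  headroom₃ true  true  false = ≤-decide
  headroom₃ true  false true  = ≤-decide
  headroom₃ true  false false = ≤-decide
  headroom₃ false true  true  = ≤-decide
  headroom₃ false true  false = ≤-decide
  headroom₃ false false true  = ≤-decide
  headroom₃ false false false = ≤-decide

  headroom₀ : ∀ w → dot c₀ w ≤ℚ dot c₀ u₀ +ℚ 2ℚ
  headroom₀ (a₁ ∷ a₂ ∷ a₃ ∷ w) =
    subst₂ _≤ℚ_ (sym (dot-c₀ a₁ a₂ a₃ w)) (cong (_+ℚ 2ℚ) (sym dot-c₀-u₀)) (headroom₃ a₁ a₂ a₃)

  exposedEdge₀ : ExposedEdge (Ccell 2 (4 + b)) u₀ v₀
  exposedEdge₀ = record
    { P-u      = C-u₀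
    ; P-v      = C-v₀
    ; c        = c₀
    ; tie      = trans dot-c₀-u₀ (sym dot-c₀-v₀)
    ; below    = below₀
    ; headroom = headroom₀
    }

  differInThree₀ : DifferInThree u₀ v₀
  differInThree₀ = record
    { l₁ = zero ; l₂ = suc zero ; l₃ = suc (suc zero)
    ; l₁≢l₂ = λ () ; l₁≢l₃ = λ () ; l₂≢l₃ = λ ()
    ; differ₁ = λ () ; differ₂ = λ () ; differ₃ = λ ()
    }

  -- 110…0 + 001 0…01 = 100 0…01 + 011 0…0  and  10 e_j + 01 e_last = 10 e_last + 01 e_j
  raised-exchange₀ : ∀ {x} → x ∈ raised 2 (4 + b) → Exchange (Ccell 2 (4 + b)) x
  raised-exchange₀ {_ ∷ x} r with ∷∈raised⁻ {k = 0} r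
  ... | refl , r₁ with ∈raised₁⇒unit-inject₁ (2 + b) r₁
  ...   | zero , refl = record
    { P-w     = Ccell-false⁺ {k = 0}
                  (∈vertices-false⁺ {k = 2} (∈vertices-true⁺ {k = 1} (unit∈vertices (fromℕ b))))
    ; P-w′    = C-u₀
    ; P-w″    = C-v₀
    ; sameSum = keep (swap (keep (sameSum-swap (replicate (suc b) false) (unit (fromℕ b)))))
    }
  ...   | suc j , refl = record
    { P-w     = Ccell-false⁺ {k = 0} (∈vertices-true⁺ {k = 1} (unit∈vertices (fromℕ (suc b))))
    ; P-w′    = C-u₀
    ; P-w″    = Ccell-false⁺ {k = 0} (∈vertices-true⁺ {k = 1} (unit∈vertices (inject₁ j)))
    ; sameSum = keep (keep (sameSum-swap (unit (inject₁ j)) (unit (fromℕ (suc b)))))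
    }

nonRootEdge : ∀ a b →
  ∃₂ λ u v → ExposedEdge (Ccell (2 + a) (2 + a + 2 + b)) u v × DifferInThree u v
nonRootEdge zero    b = Base.u₀ b , Base.v₀ b , Base.exposedEdge₀ b , Base.differInThree₀ b
nonRootEdge (suc a) b with nonRootEdge a b
... | u , v , E , D = true ∷ u , true ∷ v ,
  exposedEdge-true∷ (Ccell-true⁻ {k = suc a}) (Ccell-true⁺ P-u) (Ccell-true⁺ P-v) E , differInThree-∷ D
  where open ExposedEdge E

Ccell-¬isMatroidPolytope : ∀ a b → ¬ IsMatroidPolytope (Ccell (2 + a) (2 + a + 2 + b))
Ccell-¬isMatroidPolytope a b with nonRootEdge a b
... | _ , _ , E , D = exposedEdge⇒¬isMatroidPolytope E D

raised-exchange : ∀ a b {x} →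
  x ∈ raised (2 + a) (2 + a + 2 + b) → Exchange (Ccell (2 + a) (2 + a + 2 + b)) x
raised-exchange zero    b = Base.raised-exchange₀ b
raised-exchange (suc a) b {_ ∷ x} r with ∷∈raised⁻ {k = suc a} r
... | refl , r′ = exchange-true∷ (Ccell-true⁺ {k = suc a}) (raised-exchange a b r′)

raisedExchangeable : ∀ a b → RaisedExchangeable (2 + a) (2 + a + 2 + b)
raisedExchangeable a b = record { exchange = raised-exchange a b }

proposition4p3 : (k n : ℕ) → 2 ≤ k → k + 2 ≤ n →
  -- C is a cell of Δ(k,n)^λ ...
  (∃[ c ] (∀ v → (Ccell k n v → LowerFace k n (lam k n) c v)
               × (LowerFace k n (lam k n) c v → Ccell k n v)))
  -- ... which is maximal (no cell strictly contains it) ...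
  × (∀ c → (∀ v → Ccell k n v → LowerFace k n (lam k n) c v)
         → ∀ v → LowerFace k n (lam k n) c v → Ccell k n v)
  -- ... and is not a matroid polytope; hence λ ∉ Dr(k,n).
  × ¬ IsMatroidPolytope (Ccell k n)
  × ¬ InDressian k n (lam k n)
proposition4p3 (suc (suc a)) n (s≤s (s≤s z≤n)) k+2≤n with ℕ.m≤n⇒∃[o]m+o≡n k+2≤n
... | b , refl =
  (replicate _ 0ℚ , Ccell-isLowerFace₀ (raisedExchangeable a b)) ,
  Ccell-maximal (raisedExchangeable a b) ,
  Ccell-¬isMatroidPolytope a b ,
  ¬matroidCcell⇒∉Dressian (raisedExchangeable a b) (Ccell-¬isMatroidPolytope a b)
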